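{- Let $k\ge 2$ be an integer, let $\mathcal{A}$ and $\mathcal{B}$ be finite alphabets with $\mathrm{Card}(\mathcal{A}) = r\,\mathrm{Card}(\mathcal{B})$, where $r>1$ is an integer. Suppose there exists an $\ell$-uniform $k$-powerfree morphism $\rho\colon \mathcal{A}^{*}\to\mathcal{B}^{*}$. Then \[ h\bigl(F^{(k)}(\mathcal{B})\bigr) \;\ge\; \frac{\log r}{\ell-1}. \]
   Context: For an alphabet $\mathcal{A}$ (a finite nonempty set of letters), $\mathcal{A}^{*}$ is the free monoid of finite words over $\mathcal{A}$ (including the empty word $\varepsilon$), with concatenation. A map $\rho\colon\mathcal{A}^{*}\to\mathcal{B}^{*}$ is a morphism if $\rho(uv)=\rho(u)\rho(v)$ for all $u,v\in\mathcal{A}^{*}$; it is $\ell$-uniform if $|\rho(a)|=\ell$ for all $a\in\mathcal{A}$, where $|w|$ is the length of $w$. For a nonempty word $u$ and integer $k\ge 2$, $u^{k}$ (the concatenation of $k$ copies of $u$) is a $k$-power. A word is $k$-powerfree if none of its factors (contiguous subwords) is a $k$-power; $F^{(k)}(\mathcal{B})\subset\mathcal{B}^{*}$ denotes the set of $k$-powerfree words over $\mathcal{B}$. A morphism $\rho$ is $k$-powerfree if $\rho(u)$ is $k$-powerfree for every $k$-powerfree word $u$. For a factorial set $X\subset\mathcal{B}^{*}$ (closed under taking factors), let $c_X(n)$ be the number of words of length $n$ in $X$; the (combinatorial) entropy is $h(X)=\lim_{n\to\infty}\frac{1}{n}\log c_X(n)$. -}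

module Defs where

open import Data.Nat using (ℕ; zero; suc; _≤_; _<_; _*_; _^_; _∸_)
open import Data.Fin using (Fin)
open import Data.List using (List; []; _∷_; _++_; length; concat; replicate; [_])
open import Data.List.Membership.Propositional using (_∈_)
open import Data.List.Relation.Unary.Unique.Propositional using (Unique)
open import Data.Product using (Σ; _×_; ∃-syntax)
open import Relation.Binary.PropositionalEquality using (_≡_; _≢_)
open import Relation.Nullary using (¬_)
open import Function.Bundles using (_⇔_)

Word : Set → Set
Word A = List A

Factor : {A : Set} → Word A → Word A → Set
Factor {A} u w = Σ (Word A) λ x → Σ (Word A) λ y → x ++ u ++ y ≡ w

IsPower : {A : Set} → ℕ → Word A → Set
IsPower {A} k u = Σ (Word A) λ v → (v ≢ []) × (u ≡ concat (replicate k v))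

PowerFree : {A : Set} → ℕ → Word A → Set
PowerFree k w = ∀ u → Factor u w → ¬ IsPower k u

IsMorphism : {A B : Set} → (Word A → Word B) → Set
IsMorphism {A} ρ = ∀ (u v : Word A) → ρ (u ++ v) ≡ ρ u ++ ρ v

IsUniform : {A B : Set} → ℕ → (Word A → Word B) → Set
IsUniform ℓ ρ = ∀ a → length (ρ [ a ]) ≡ ℓ

IsPowerFreeMorphism : {A B : Set} → ℕ → (Word A → Word B) → Set
IsPowerFreeMorphism k ρ = ∀ u → PowerFree k u → PowerFree k (ρ u)

IsPFCount : ℕ → (m : ℕ) → ℕ → ℕ → Set
IsPFCount k m n c =
  Σ (List (Word (Fin m))) λ L →
    Unique L × (∀ w → (w ∈ L) ⇔ ((length w ≡ n) × PowerFree k w)) × (length L ≡ c)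

-- "h(F^(k)(Fin m)) ≥ log r / (ℓ - 1)", for ℓ ≥ 1, written without reals:
-- since h = lim (1/n) log c(n), this holds iff for every rational p/q < 1,
-- eventually (1/n) log c(n) ≥ (p/q) log r / (ℓ-1), i.e.
-- r^(n p) ≤ c(n)^((ℓ-1) q).
EntropyAtLeastLogOver : (k m r ℓ : ℕ) → Set
EntropyAtLeastLogOver k m r ℓ =
  ∀ p q → p < q →
    ∃[ N ] ∀ n → N ≤ n → ∀ c → IsPFCount k m n c →
      r ^ (n * p) ≤ c ^ ((ℓ ∸ 1) * q)

{-# OPTIONS --safe #-}
-- If two letters a ≠ b had the same image under ρ, the k-powerfree word b a^(k-1) would be sent to the
-- k-th power ρ(a)^k. So ρ is injective on words of equal length, and ℓ = 1 is impossible, as it would embed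
-- r m letters into m. Writing c(n) for the number of k-powerfree words of length n over m letters, we get
-- c(ℓ t) ≥ r^t c(t): each such word of length t has r^t lifts to the r m letters, all k-powerfree since they
-- project back onto it, and ρ maps them injectively to k-powerfree words of length ℓ t. Iterating from t = 1
-- gives c(ℓ^i)^(ℓ-1) ≥ r^(ℓ^i - 1). As c is submultiplicative, c(n)^K m^n ≥ c(ℓ^i) for K = ⌊ℓ^i / n⌋; were
-- c(n)^(ℓ-1) < r^n, Bernoulli's inequality would bound K, but K grows with i. Hence c(n)^(ℓ-1) ≥ r^n for
-- every n ≥ 1, which is stronger than the entropy bound.
module Submission where

open import Defs
open import Data.Empty using (⊥-elim)
open import Data.Fin using (Fin; combine; remQuot) renaming (zero to fzero; _≟_ to _≟ᶠ_)
open import Data.Fin.Properties using (remQuot-combine)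
open import Data.List
  using (List; []; _∷_; _++_; length; concat; replicate; [_]; map; take; drop;
         zipWith; unzipWith; cartesianProductWith; cartesianProduct; allFin)
open import Data.List.Properties
  using (∷-injective; ∷-injectiveˡ; ∷-injectiveʳ; length-++; length-++-≤ˡ; length-map;
         length-take; length-drop; length-zipWith; length-tabulate; map-++; ++-identityʳ;
         ++-assoc; ++-cancelˡ; ++-conicalˡ; take++drop≡id)
open import Data.List.Membership.Propositional using (_∈_)
open import Data.List.Membership.Propositional.Properties
  using (∈-cartesianProductWith⁺; ∈-cartesianProductWith⁻; ∈-cartesianProduct⁻; ∈-map⁻;
         ∈-allFin; ∈-∃++; ∈-++⁻; ∈-++⁺ˡ; ∈-++⁺ʳ)
open import Data.List.Relation.Binary.Subset.Propositional using (_⊆_)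
open import Data.List.Relation.Unary.Any using (here; there)
import Data.List.Relation.Unary.All as All
import Data.List.Relation.Unary.All.Properties as All
open import Data.List.Relation.Unary.AllPairs using ([]; _∷_)
open import Data.List.Relation.Unary.Unique.Propositional using (Unique)
open import Data.List.Relation.Unary.Unique.Propositional.Properties
  using (cartesianProductWith⁺; cartesianProduct⁺; map⁺; allFin⁺; Unique[x∷xs]⇒x∉xs)
open import Data.Nat
  using (ℕ; zero; suc; _≤_; _<_; _*_; _+_; _^_; _∸_; _⊓_; z≤n; s≤s; NonZero; >-nonZero)
open import Data.Nat.Properties
open import Data.Nat.DivMod using (_/_; _%_; m≡m%n+[m/n]*n; m%n<n; m*n/n≡m; /-monoˡ-≤)
open import Data.Nat.Tactic.RingSolver using (solve-∀)
open import Data.Product using (∃-syntax; Σ-syntax; _×_; _,_; proj₁; proj₂; swap)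
open import Data.Sum using (_⊎_; inj₁; inj₂)
open import Function using (id; _∘′_)
open import Function.Bundles using (Equivalence)
open import Relation.Binary.Definitions using (DecidableEquality)
open import Relation.Binary.PropositionalEquality hiding ([_])
open import Relation.Nullary.Decidable using (decidable-stable)

^-distribʳ-* : ∀ m n o → (m * n) ^ o ≡ m ^ o * n ^ o
^-distribʳ-* m n zero    = refl
^-distribʳ-* m n (suc o) = trans (cong (m * n *_) (^-distribʳ-* m n o)) (regroup m n (m ^ o) (n ^ o))
  where
  regroup : ∀ m n x y → m * n * (x * y) ≡ m * x * (n * y)
  regroup = solve-∀

^-comm-exponents : ∀ m n o → (m ^ n) ^ o ≡ (m ^ o) ^ n
^-comm-exponents m n o = begin
  (m ^ n) ^ o ≡⟨ ^-*-assoc m n o ⟩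
  m ^ (n * o) ≡⟨ cong (m ^_) (*-comm n o) ⟩
  m ^ (o * n) ≡⟨ ^-*-assoc m o n ⟨
  (m ^ o) ^ n ∎
  where open ≡-Reasoning

n<[2+m]^n : ∀ m n → n < suc (suc m) ^ n
n<[2+m]^n m zero    = s≤s z≤n
n<[2+m]^n m (suc n) = ≤-trans (s≤s (n<[2+m]^n m n)) ℓⁿ<ℓ*ℓⁿ
  where
  ℓ : ℕ
  ℓ = suc (suc m)
  ℓⁿ<ℓ*ℓⁿ : ℓ ^ n < ℓ * ℓ ^ n
  ℓⁿ<ℓ*ℓⁿ = subst (ℓ ^ n <_) (*-comm (ℓ ^ n) ℓ) (m<m*n (ℓ ^ n) ℓ {{m^n≢0 ℓ n}} (s≤s (s≤s z≤n)))

-- Bernoulli's inequality (1 + 1/m)^n ≥ 1 + n/m, cleared of denominators.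
m^n*[m+n]≤m*[1+m]^n : ∀ m n → m ^ n * (m + n) ≤ m * suc m ^ n
m^n*[m+n]≤m*[1+m]^n m zero    = ≤-reflexive (base m)
  where
  base : ∀ m → 1 * (m + 0) ≡ m * 1
  base = solve-∀
m^n*[m+n]≤m*[1+m]^n m (suc n) = begin
  m * m ^ n * (m + suc n)           ≡⟨ split m (m ^ n) n ⟩
  m * (m ^ n * (m + n)) + m * m ^ n ≤⟨ +-mono-≤ (*-monoʳ-≤ m (m^n*[m+n]≤m*[1+m]^n m n))
                                                 (*-monoʳ-≤ m (^-monoˡ-≤ n (n≤1+n m))) ⟩
  m * (m * suc m ^ n) + m * suc m ^ n ≡⟨ merge m (suc m ^ n) ⟩
  m * (suc m * suc m ^ n)            ∎
  where
  open ≤-Reasoning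
  split : ∀ m x n → m * x * (m + suc n) ≡ m * (x * (m + n)) + m * x
  split = solve-∀
  merge : ∀ m y → m * (m * y) + m * y ≡ m * ((1 + m) * y)
  merge = solve-∀

m<n⇒n^k≤o*m^k⇒k≤o*m : ∀ {m n o} k → m < n → n ^ k ≤ o * m ^ k → k ≤ o * m
m<n⇒n^k≤o*m^k⇒k≤o*m zero    _       _ = z≤n
m<n⇒n^k≤o*m^k⇒k≤o*m {zero} {suc n} {o} (suc k) _ nᵏ≤0 =
  ⊥-elim (<⇒≱ (m^n>0 (suc n) (suc k)) (≤-trans nᵏ≤0 (≤-reflexive (*-zeroʳ o))))
m<n⇒n^k≤o*m^k⇒k≤o*m {m@(suc _)} {n} {o} k m<n nᵏ≤omᵏ =
  ≤-trans (m≤n+m k m) (*-cancelˡ-≤ (m ^ k) {{m^n≢0 m k}} (begin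
    m ^ k * (m + k)  ≤⟨ m^n*[m+n]≤m*[1+m]^n m k ⟩
    m * suc m ^ k    ≤⟨ *-monoʳ-≤ m (^-monoˡ-≤ k m<n) ⟩
    m * n ^ k        ≤⟨ *-monoʳ-≤ m nᵏ≤omᵏ ⟩
    m * (o * m ^ k)  ≡⟨ rearrange m o (m ^ k) ⟩
    m ^ k * (o * m)  ∎))
  where
  open ≤-Reasoning
  rearrange : ∀ m o x → m * (o * x) ≡ x * (o * m)
  rearrange = solve-∀

length-cartesianProductWith : ∀ {A B C : Set} (f : A → B → C) xs ys →
  length (cartesianProductWith f xs ys) ≡ length xs * length ys
length-cartesianProductWith f []       ys = refl
length-cartesianProductWith f (x ∷ xs) ys = trans (length-++ (map (f x) ys))
  (cong₂ _+_ (length-map (f x) ys) (length-cartesianProductWith f xs ys))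

unzipWith-zipWith : ∀ {A B C : Set} {f : A → B → C} {g : C → A × B} →
  (∀ x y → g (f x y) ≡ (x , y)) →
  ∀ {xs ys} → length xs ≡ length ys → unzipWith g (zipWith f xs ys) ≡ (xs , ys)
unzipWith-zipWith g∘f≡id {[]}     {[]}     _ = refl
unzipWith-zipWith {f = f} {g} g∘f≡id {x ∷ xs} {y ∷ ys} l rewrite g∘f≡id x y =
  cong₂ _,_ (cong (x ∷_) (cong proj₁ unzip-zip)) (cong (y ∷_) (cong proj₂ unzip-zip))
  where
  unzip-zip : unzipWith g (zipWith f xs ys) ≡ (xs , ys)
  unzip-zip = unzipWith-zipWith g∘f≡id (suc-injective l)

proj₂-unzipWith : ∀ {A B C : Set} (g : A → B × C) xs → proj₂ (unzipWith g xs) ≡ map (proj₂ ∘′ g) xs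
proj₂-unzipWith g []       = refl
proj₂-unzipWith g (x ∷ xs) = cong (proj₂ (g x) ∷_) (proj₂-unzipWith g xs)

++-injective : ∀ {A : Set} {xs ys as bs : List A} →
  length xs ≡ length ys → xs ++ as ≡ ys ++ bs → xs ≡ ys × as ≡ bs
++-injective {xs = []}     {[]}     _ eq = refl , eq
++-injective {xs = x ∷ xs} {y ∷ ys} l eq with ∷-injective eq
... | refl , eq′ with ++-injective {xs = xs} {ys} (suc-injective l) eq′
... | refl , as≡bs = refl , as≡bs

unique-map⁺ : ∀ {A B : Set} (f : A → B) {xs : List A} →
  (∀ {x y} → x ∈ xs → y ∈ xs → f x ≡ f y → x ≡ y) → Unique xs → Unique (map f xs)
unique-map⁺ f {[]}     _   []           = []
unique-map⁺ f {x ∷ xs} inj (x∉xs ∷ uxs) =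
  All.map⁺ (All.tabulate λ y∈xs fx≡fy → All.lookup x∉xs y∈xs (inj (here refl) (there y∈xs) fx≡fy))
  ∷ unique-map⁺ f (λ x∈ y∈ → inj (there x∈) (there y∈)) uxs

⊆⇒length≤ : ∀ {A : Set} {xs ys : List A} → Unique xs → xs ⊆ ys → length xs ≤ length ys
⊆⇒length≤ {xs = []}     _               _  = z≤n
⊆⇒length≤ {xs = x ∷ xs} ux@(_ ∷ uxs) xs⊆ys with ∈-∃++ (xs⊆ys (here refl))
... | ys₁ , ys₂ , refl = begin
  suc (length xs)                ≤⟨ s≤s (⊆⇒length≤ uxs xs⊆ys₁++ys₂) ⟩
  suc (length (ys₁ ++ ys₂))      ≡⟨ cong suc (length-++ ys₁) ⟩
  suc (length ys₁ + length ys₂)  ≡⟨ +-suc (length ys₁) (length ys₂) ⟨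
  length ys₁ + suc (length ys₂)  ≡⟨ length-++ ys₁ ⟨
  length (ys₁ ++ x ∷ ys₂)        ∎
  where
  open ≤-Reasoning
  xs⊆ys₁++ys₂ : xs ⊆ ys₁ ++ ys₂
  xs⊆ys₁++ys₂ y∈xs with ∈-++⁻ ys₁ (xs⊆ys (there y∈xs))
  ... | inj₁ y∈ys₁         = ∈-++⁺ˡ y∈ys₁
  ... | inj₂ (here refl)   = ⊥-elim (Unique[x∷xs]⇒x∉xs ux y∈xs)
  ... | inj₂ (there y∈ys₂) = ∈-++⁺ʳ ys₁ y∈ys₂

module _ {A : Set} where

  allWords : List A → ℕ → List (Word A)
  allWords as zero    = [ [] ]
  allWords as (suc n) = cartesianProductWith _∷_ as (allWords as n)

  length-allWords : ∀ as n → length (allWords as n) ≡ length as ^ n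
  length-allWords as zero    = refl
  length-allWords as (suc n) = trans (length-cartesianProductWith _∷_ as (allWords as n))
    (cong (length as *_) (length-allWords as n))

  allWords-unique : ∀ {as} → Unique as → ∀ n → Unique (allWords as n)
  allWords-unique uas zero    = All.[] ∷ []
  allWords-unique uas (suc n) = cartesianProductWith⁺ _∷_ ∷-injective uas (allWords-unique uas n)

  ∈-allWords⁺ : ∀ {as} → (∀ a → a ∈ as) → ∀ w → w ∈ allWords as (length w)
  ∈-allWords⁺ all∈ []      = here refl
  ∈-allWords⁺ all∈ (a ∷ w) = ∈-cartesianProductWith⁺ _∷_ (all∈ a) (∈-allWords⁺ all∈ w)

  ∈-allWords⁻ : ∀ as n {w} → w ∈ allWords as n → length w ≡ n
  ∈-allWords⁻ as zero    (here refl) = refl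
  ∈-allWords⁻ as (suc n) w∈ with ∈-cartesianProductWith⁻ _∷_ as (allWords as n) w∈
  ... | _ , _ , _ , v∈ , refl = cong suc (∈-allWords⁻ as n v∈)

  blocks : List (Word A) → ℕ → List (Word A) → List (Word A)
  blocks us zero    vs = vs
  blocks us (suc K) vs = cartesianProductWith _++_ us (blocks us K vs)

  length-blocks : ∀ us K vs → length (blocks us K vs) ≡ length us ^ K * length vs
  length-blocks us zero    vs = sym (+-identityʳ (length vs))
  length-blocks us (suc K) vs = begin
    length (cartesianProductWith _++_ us (blocks us K vs)) ≡⟨ length-cartesianProductWith _++_ us _ ⟩
    length us * length (blocks us K vs)                   ≡⟨ cong (length us *_) (length-blocks us K vs) ⟩
    length us * (length us ^ K * length vs)               ≡⟨ *-assoc (length us) _ _ ⟨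
    length us ^ suc K * length vs                         ∎
    where open ≡-Reasoning

  ∈-blocks : (P : Word A → Set) → (∀ {u v} → P (u ++ v) → P u × P v) →
    ∀ {n d us vs} → (∀ {w} → length w ≡ n → P w → w ∈ us) → (∀ {w} → length w ≡ d → P w → w ∈ vs) →
    ∀ K {w} → length w ≡ K * n + d → P w → w ∈ blocks us K vs
  ∈-blocks P split             us-complete vs-complete zero    |w| Pw = vs-complete |w| Pw
  ∈-blocks P split {n} {d} {us} {vs} us-complete vs-complete (suc K) {w} |w| Pw =
    subst (_∈ blocks us (suc K) vs) (take++drop≡id n w)
      (∈-cartesianProductWith⁺ _++_
        (us-complete |take| (proj₁ pieces))
        (∈-blocks P split us-complete vs-complete K |drop| (proj₂ pieces)))
    where
    |w|′ : length w ≡ n + (K * n + d)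
    |w|′ = trans |w| (+-assoc n (K * n) d)
    pieces : P (take n w) × P (drop n w)
    pieces = split (subst P (sym (take++drop≡id n w)) Pw)
    |take| : length (take n w) ≡ n
    |take| = trans (length-take n w) (m≤n⇒m⊓n≡m (subst (n ≤_) (sym |w|′) (m≤m+n n _)))
    |drop| : length (drop n w) ≡ K * n + d
    |drop| = trans (length-drop n w) (trans (cong (_∸ n) |w|′) (m+n∸m≡n n _))

-- Factors and powers

module _ {A : Set} where

  factor-refl : (w : Word A) → Factor w w
  factor-refl w = [] , [] , ++-identityʳ w

  factor-trans : {u v w : Word A} → Factor u v → Factor v w → Factor u w
  factor-trans {u} (x , y , refl) (x′ , y′ , refl) = x′ ++ x , y ++ y′ , (begin
    (x′ ++ x) ++ u ++ y ++ y′   ≡⟨ ++-assoc x′ x _ ⟩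
    x′ ++ x ++ u ++ y ++ y′     ≡⟨ cong (λ z → x′ ++ x ++ z) (++-assoc u y y′) ⟨
    x′ ++ x ++ (u ++ y) ++ y′   ≡⟨ cong (x′ ++_) (++-assoc x (u ++ y) y′) ⟨
    x′ ++ (x ++ u ++ y) ++ y′   ∎)
    where open ≡-Reasoning

  length-factor : {u w : Word A} → Factor u w → length u ≤ length w
  length-factor {u} (x , y , refl) = ≤-trans (length-++-≤ˡ u) (subst (length (u ++ y) ≤_)
    (sym (length-++ x)) (m≤n+m _ (length x)))

  factor-length≥⇒≡ : {u w : Word A} → Factor u w → length w ≤ length u → u ≡ w
  factor-length≥⇒≡ {u} ([] , [] , u++[]≡w) _ = trans (sym (++-identityʳ u)) u++[]≡w
  factor-length≥⇒≡ (_ ∷ x , y , refl) w≤u = ⊥-elim (≤⇒≯ (length-factor (x , y , refl)) w≤u)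
  factor-length≥⇒≡ {u} ([] , _ ∷ y , refl) w≤u =
    ⊥-elim (≤⇒≯ w≤u (subst (length u <_) (sym (length-++ u)) (m<m+n (length u) (s≤s z≤n))))

  powerFree-factor : ∀ {k} {v w : Word A} → Factor v w → PowerFree k w → PowerFree k v
  powerFree-factor v⊑w pf u u⊑v = pf u (factor-trans u⊑v v⊑w)

  powerFree-++⁻ : ∀ {k} {u v : Word A} → PowerFree k (u ++ v) → PowerFree k u × PowerFree k v
  powerFree-++⁻ {k} {u} {v} pf =
    powerFree-factor {k} {u} ([] , v , refl) pf ,
    powerFree-factor {k} {v} (u , [] , cong (u ++_) (++-identityʳ v)) pf

  length-power : ∀ K (v : Word A) → length (concat (replicate K v)) ≡ K * length v
  length-power zero    v = refl
  length-power (suc K) v = trans (length-++ v) (cong (length v +_) (length-power K v))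

  ≤-length-power : ∀ K {v : Word A} → v ≢ [] → K ≤ length (concat (replicate K v))
  ≤-length-power K {[]}    v≢[] = ⊥-elim (v≢[] refl)
  ≤-length-power K {a ∷ v} _    = subst (K ≤_) (sym (length-power K (a ∷ v))) (m≤m*n K (suc (length v)))

  powerFree-short : ∀ {k} {w : Word A} → length w < k → PowerFree k w
  powerFree-short {k} w<k u u⊑w (v , v≢[] , refl) =
    <⇒≱ w<k (≤-trans (≤-length-power k v≢[]) (length-factor u⊑w))

  powerFree-b∷aᵏ⁻¹ : ∀ j {a b : A} → b ≢ a → PowerFree (2 + j) (b ∷ concat (replicate (suc j) [ a ]))
  powerFree-b∷aᵏ⁻¹ j {a} {b} b≢a u u⊑W (v , v≢[] , refl) = letter-power≢W v |v|≡1 vᴷ≡W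
    where
    K : ℕ
    K = 2 + j
    W : Word A
    W = b ∷ concat (replicate (suc j) [ a ])
    |W|≡K : length W ≡ K
    |W|≡K = cong suc (trans (length-power (suc j) [ a ]) (*-identityʳ (suc j)))
    vᴷ≡W : concat (replicate K v) ≡ W
    vᴷ≡W = factor-length≥⇒≡ u⊑W (subst (_≤ length u) (sym |W|≡K) (≤-length-power K v≢[]))
    |v|≡1 : length v ≡ 1
    |v|≡1 = *-cancelˡ-≡ (length v) 1 K
      (trans (sym (length-power K v)) (trans (cong length vᴷ≡W) (trans |W|≡K (sym (*-identityʳ K)))))
    letter-power≢W : ∀ v → length v ≡ 1 → concat (replicate K v) ≢ W
    letter-power≢W (c ∷ []) _ cᴷ≡W =
      b≢a (trans (sym (∷-injectiveˡ cᴷ≡W)) (∷-injectiveˡ (∷-injectiveʳ cᴷ≡W)))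

-- Morphisms

module _ {A B : Set} (φ : Word A → Word B) (φ-++ : IsMorphism φ) where

  φ-[] : φ [] ≡ []
  φ-[] = sym (++-cancelˡ (φ []) [] (φ []) (trans (++-identityʳ (φ [])) (φ-++ [] [])))

  φ-power : ∀ K v → φ (concat (replicate K v)) ≡ concat (replicate K (φ v))
  φ-power zero    v = φ-[]
  φ-power (suc K) v = trans (φ-++ v _) (cong (φ v ++_) (φ-power K v))

  φ-factor : ∀ {u w} → Factor u w → Factor (φ u) (φ w)
  φ-factor {u} (x , y , refl) = φ x , φ y , sym (trans (φ-++ x (u ++ y)) (cong (φ x ++_) (φ-++ u y)))

  φ-nonEmpty : (∀ a → φ [ a ] ≢ []) → ∀ {v} → v ≢ [] → φ v ≢ []
  φ-nonEmpty nonErasing {[]}    v≢[] = ⊥-elim (v≢[] refl)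
  φ-nonEmpty nonErasing {a ∷ v} _    φv≡[] =
    nonErasing a (++-conicalˡ (φ [ a ]) (φ v) (trans (sym (φ-++ [ a ] v)) φv≡[]))

  powerFree-reflect : ∀ {k w} → (∀ a → φ [ a ] ≢ []) → PowerFree k (φ w) → PowerFree k w
  powerFree-reflect {k} nonErasing pf u u⊑w (v , v≢[] , refl) =
    pf (φ u) (φ-factor u⊑w) (φ v , φ-nonEmpty nonErasing v≢[] , φ-power k v)

  letter-injective : ∀ j → DecidableEquality A → IsPowerFreeMorphism (2 + j) φ →
    (∀ a → φ [ a ] ≢ []) → ∀ {b a} → φ [ b ] ≡ φ [ a ] → b ≡ a
  letter-injective j _≟_ pf nonErasing {b} {a} φb≡φa = decidable-stable (b ≟ a) λ b≢a →
    pf W (powerFree-b∷aᵏ⁻¹ j b≢a) (φ W) (factor-refl (φ W)) (φ [ a ] , nonErasing a , φW≡φaᴷ)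
    where
    W : Word A
    W = b ∷ concat (replicate (suc j) [ a ])
    φW≡φaᴷ : φ W ≡ concat (replicate (2 + j) (φ [ a ]))
    φW≡φaᴷ = trans (φ-++ [ b ] _) (cong₂ _++_ φb≡φa (φ-power (suc j) [ a ]))

  module _ {ℓ} (φ-uniform : IsUniform ℓ φ) where

    length-φ : ∀ u → length (φ u) ≡ ℓ * length u
    length-φ []      = trans (cong length φ-[]) (sym (*-zeroʳ ℓ))
    length-φ (a ∷ u) = begin
      length (φ ([ a ] ++ u))         ≡⟨ cong length (φ-++ [ a ] u) ⟩
      length (φ [ a ] ++ φ u)         ≡⟨ length-++ (φ [ a ]) ⟩
      length (φ [ a ]) + length (φ u) ≡⟨ cong₂ _+_ (φ-uniform a) (length-φ u) ⟩
      ℓ + ℓ * length u                ≡⟨ *-suc ℓ (length u) ⟨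
      ℓ * suc (length u)              ∎
      where open ≡-Reasoning

    φ-injective : (∀ {a b} → φ [ a ] ≡ φ [ b ] → a ≡ b) →
      ∀ {u v} → length u ≡ length v → φ u ≡ φ v → u ≡ v
    φ-injective inj {[]}    {[]}    _ _ = refl
    φ-injective inj {a ∷ u} {b ∷ v} |u|≡|v| φu≡φv
      with ++-injective (trans (φ-uniform a) (sym (φ-uniform b)))
             (trans (sym (φ-++ [ a ] u)) (trans φu≡φv (φ-++ [ b ] v)))
    ... | φa≡φb , φu≡φv′ = cong₂ _∷_ (inj φa≡φb) (φ-injective inj (suc-injective |u|≡|v|) φu≡φv′)

uniform⇒nonErasing : ∀ {A B : Set} {φ : Word A → Word B} {e} → IsUniform (suc e) φ → ∀ a → φ [ a ] ≢ []
uniform⇒nonErasing φ-uniform a φa≡[] with trans (sym (φ-uniform a)) (cong length φa≡[])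
... | ()

uniform₁⇒alphabet≤ : ∀ {a b} j {φ : Word (Fin a) → Word (Fin b)} →
  IsMorphism φ → IsUniform 1 φ → IsPowerFreeMorphism (2 + j) φ → a ≤ b
uniform₁⇒alphabet≤ {a} {b} j {φ} φ-++ φ-uniform φ-powerFree = begin
  a                                   ≡⟨ trans (length-map image (allFin a)) (length-tabulate id) ⟨
  length (map image (allFin a))       ≤⟨ ⊆⇒length≤ (map⁺ image-injective (allFin⁺ a)) images⊆words ⟩
  length (allWords (allFin b) 1)      ≡⟨ length-allWords (allFin b) 1 ⟩
  length (allFin b) * 1               ≡⟨ trans (*-identityʳ _) (length-tabulate id) ⟩
  b                                   ∎
  where
  open ≤-Reasoning
  image : Fin a → Word (Fin b)
  image x = φ [ x ]
  image-injective : ∀ {x y} → image x ≡ image y → x ≡ y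
  image-injective = letter-injective φ φ-++ j _≟ᶠ_ φ-powerFree (uniform⇒nonErasing {φ = φ} φ-uniform)
  images⊆words : map image (allFin a) ⊆ allWords (allFin b) 1
  images⊆words w∈ with ∈-map⁻ image w∈
  ... | x , _ , refl =
    subst (λ n → image x ∈ allWords (allFin b) n) (φ-uniform x) (∈-allWords⁺ ∈-allFin (image x))

-- Counting power-free words

PowerFreeWord : ∀ {A : Set} → ℕ → ℕ → Word A → Set
PowerFreeWord k n w = length w ≡ n × PowerFree k w

PowerFreeSet : ∀ {A : Set} → ℕ → ℕ → List (Word A) → Set
PowerFreeSet k n T = Unique T × (∀ {w} → w ∈ T → PowerFreeWord k n w)

powerFreeSet-length≤ : ∀ {k m n c K d} {T : List (Word (Fin m))} →
  IsPFCount k m n c → PowerFreeSet k (K * n + d) T → length T ≤ c ^ K * m ^ d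
powerFreeSet-length≤ {k} {m} {n} {c} {K} {d} {T} (L , _ , L-complete , |L|≡c) (T-unique , T-powerFree) =
  begin
    length T                                      ≤⟨ ⊆⇒length≤ T-unique T⊆blocks ⟩
    length (blocks L K (allWords (allFin m) d))   ≡⟨ length-blocks L K _ ⟩
    length L ^ K * length (allWords (allFin m) d) ≡⟨ cong₂ (λ x y → x ^ K * y) |L|≡c |allWords| ⟩
    c ^ K * m ^ d                                 ∎
  where
  open ≤-Reasoning
  |allWords| : length (allWords (allFin m) d) ≡ m ^ d
  |allWords| = trans (length-allWords (allFin m) d) (cong (_^ d) (length-tabulate id))
  T⊆blocks : T ⊆ blocks L K (allWords (allFin m) d)
  T⊆blocks w∈T = ∈-blocks (PowerFree k) (λ {u} {v} → powerFree-++⁻ {k = k} {u} {v})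
    (λ |w| w-pf → Equivalence.from (L-complete _) (|w| , w-pf))
    (λ {w} |w| _ → subst (λ d → w ∈ allWords (allFin m) d) |w| (∈-allWords⁺ ∈-allFin w))
    K (proj₁ (T-powerFree w∈T)) (proj₂ (T-powerFree w∈T))

module _ {j e r m : ℕ} {ρ : Word (Fin (r * m)) → Word (Fin m)}
         (ρ-++ : IsMorphism ρ) (ρ-uniform : IsUniform (suc e) ρ)
         (ρ-powerFree : IsPowerFreeMorphism (2 + j) ρ) where

  lift-powerFreeSet : ∀ {t T} → PowerFreeSet (2 + j) t T →
    ∃[ T′ ] PowerFreeSet (2 + j) (suc e * t) T′ × length T′ ≡ length T * r ^ t
  lift-powerFreeSet {t} {T} (T-unique , T-powerFree) =
    map image pairs , (image-unique , image-powerFree) , |image|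
    where
    pairs : List (Word (Fin m) × Word (Fin r))
    pairs = cartesianProduct T (allWords (allFin r) t)

    lift : Word (Fin m) × Word (Fin r) → Word (Fin (r * m))
    lift (w , s) = zipWith combine s w

    image : Word (Fin m) × Word (Fin r) → Word (Fin m)
    image = ρ ∘′ lift

    unlift-lift : ∀ {w s} → length s ≡ length w → unzipWith (remQuot {r} m) (lift (w , s)) ≡ (s , w)
    unlift-lift = unzipWith-zipWith (λ i b → remQuot-combine i b)

    length-lift : ∀ {w s} → length s ≡ length w → length (lift (w , s)) ≡ length w
    length-lift {w} {s} |s|≡|w| =
      trans (length-zipWith combine s w) (trans (cong (_⊓ length w) |s|≡|w|) (⊓-idem (length w)))

    lift-powerFree : ∀ {w s} → PowerFree (2 + j) w → length s ≡ length w →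
      PowerFree (2 + j) (lift (w , s))
    lift-powerFree {w} {s} w-pf |s|≡|w| =
      powerFree-reflect (map unlift-letter) (map-++ unlift-letter) {2 + j} (λ _ ())
        (subst (PowerFree (2 + j)) (sym projection) w-pf)
      where
      unlift-letter : Fin (r * m) → Fin m
      unlift-letter = proj₂ ∘′ remQuot {r} m
      projection : map unlift-letter (lift (w , s)) ≡ w
      projection = trans (sym (proj₂-unzipWith (remQuot {r} m) _))
        (cong proj₂ (unlift-lift {w} {s} |s|≡|w|))

    pair-info : ∀ {w s} → (w , s) ∈ pairs → PowerFreeWord (2 + j) t w × length s ≡ t
    pair-info ws∈ with ∈-cartesianProduct⁻ T _ ws∈
    ... | w∈T , s∈ = T-powerFree w∈T , ∈-allWords⁻ (allFin r) t s∈

    image-injective : ∀ {x y} → x ∈ pairs → y ∈ pairs → image x ≡ image y → x ≡ y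
    image-injective {w , s} {w′ , s′} x∈ y∈ ρ-lift≡ with pair-info x∈ | pair-info y∈
    ... | (|w| , _) , |s| | (|w′| , _) , |s′| = cong swap (begin
      (s , w)                                    ≡⟨ unlift-lift |s|≡|w| ⟨
      unzipWith (remQuot {r} m) (lift (w , s))   ≡⟨ cong (unzipWith (remQuot {r} m)) lift≡ ⟩
      unzipWith (remQuot {r} m) (lift (w′ , s′)) ≡⟨ unlift-lift |s′|≡|w′| ⟩
      (s′ , w′)                                  ∎)
      where
      open ≡-Reasoning
      |s|≡|w| : length s ≡ length w
      |s|≡|w| = trans |s| (sym |w|)
      |s′|≡|w′| : length s′ ≡ length w′
      |s′|≡|w′| = trans |s′| (sym |w′|)
      lift≡ : lift (w , s) ≡ lift (w′ , s′)
      lift≡ = φ-injective ρ ρ-++ ρ-uniform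
        (letter-injective ρ ρ-++ j _≟ᶠ_ ρ-powerFree (uniform⇒nonErasing {φ = ρ} ρ-uniform))
        (trans (length-lift {w} {s} |s|≡|w|)
          (trans |w| (trans (sym |w′|) (sym (length-lift {w′} {s′} |s′|≡|w′|)))))
        ρ-lift≡

    image-unique : Unique (map image pairs)
    image-unique = unique-map⁺ image image-injective
      (cartesianProduct⁺ T-unique (allWords-unique (allFin⁺ r) t))

    image-powerFree : ∀ {v} → v ∈ map image pairs → PowerFreeWord (2 + j) (suc e * t) v
    image-powerFree v∈ with ∈-map⁻ image v∈
    ... | (w , s) , ws∈ , refl with pair-info ws∈
    ... | (|w| , w-pf) , |s| =
      trans (length-φ ρ ρ-++ ρ-uniform (lift (w , s)))
        (cong (suc e *_) (trans (length-lift {w} {s} |s|≡|w|) |w|)) ,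
      ρ-powerFree (lift (w , s)) (lift-powerFree w-pf |s|≡|w|)
      where
      |s|≡|w| : length s ≡ length w
      |s|≡|w| = trans |s| (sym |w|)

    |image| : length (map image pairs) ≡ length T * r ^ t
    |image| = trans (length-map image pairs) (trans (length-cartesianProductWith _,_ T _)
      (cong (length T *_) (trans (length-allWords (allFin r) t) (cong (_^ t) (length-tabulate id)))))

  powerFreeSets-ℓ^ : Fin m → ∀ i →
    ∃[ T ] PowerFreeSet (2 + j) (suc e ^ i) T × r ^ (suc e ^ i) ≤ r * length T ^ e
  powerFreeSets-ℓ^ b zero =
    [ [ b ] ] ,
    (All.[] ∷ [] , λ { (here refl) → refl , powerFree-short {k = 2 + j} (s≤s (s≤s z≤n)) }) ,
    ≤-reflexive (cong (r *_) (sym (^-zeroˡ e)))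
  powerFreeSets-ℓ^ b (suc i) with powerFreeSets-ℓ^ b i
  ... | T , T-set , T-large with lift-powerFreeSet T-set
  ... | T′ , T′-set , |T′| = T′ , T′-set , (begin
    r ^ (t + e * t)                  ≡⟨ ^-distribˡ-+-* r t (e * t) ⟩
    r ^ t * r ^ (e * t)              ≡⟨ cong (λ x → r ^ t * r ^ x) (*-comm e t) ⟩
    r ^ t * r ^ (t * e)              ≡⟨ cong (r ^ t *_) (^-*-assoc r t e) ⟨
    r ^ t * (r ^ t) ^ e              ≤⟨ *-monoˡ-≤ _ T-large ⟩
    r * length T ^ e * (r ^ t) ^ e   ≡⟨ *-assoc r _ _ ⟩
    r * (length T ^ e * (r ^ t) ^ e) ≡⟨ cong (r *_) (^-distribʳ-* (length T) (r ^ t) e) ⟨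
    r * (length T * r ^ t) ^ e       ≡⟨ cong (λ x → r * x ^ e) |T′| ⟨
    r * length T′ ^ e                ∎)
    where
    open ≤-Reasoning
    t : ℕ
    t = suc e ^ i

powerFreeCount-lowerBound : ∀ {k m r e n c} .{{_ : NonZero m}} .{{_ : NonZero r}} .{{_ : NonZero n}} →
  (∀ i → Σ[ T ∈ List (Word (Fin m)) ]
     PowerFreeSet k (suc (suc e) ^ i) T × r ^ (suc (suc e) ^ i) ≤ r * length T ^ suc e) →
  IsPFCount k m n c → r ^ n ≤ c ^ suc e
powerFreeCount-lowerBound {k} {m} {r} {e} {n} {c} large count = ≮⇒≥ λ cᵉ<rⁿ →
  <⇒≱ C*A<K (m<n⇒n^k≤o*m^k⇒k≤o*m {o = C} K cᵉ<rⁿ rⁿᴷ≤C*cᵉᴷ)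
  where
  open ≤-Reasoning
  ℓ A C i K d : ℕ
  ℓ = suc (suc e)
  A = c ^ suc e
  C = r * (m ^ n) ^ suc e
  i = suc (C * A) * n
  K = ℓ ^ i / n
  d = ℓ ^ i % n

  T : List (Word (Fin m))
  T = proj₁ (large i)
  T-set : PowerFreeSet k (ℓ ^ i) T
  T-set = proj₁ (proj₂ (large i))
  T-large : r ^ (ℓ ^ i) ≤ r * length T ^ suc e
  T-large = proj₂ (proj₂ (large i))

  C*A<K : C * A < K
  C*A<K = begin-strict
    C * A                <⟨ n<1+n (C * A) ⟩
    suc (C * A)          ≡⟨ m*n/n≡m (suc (C * A)) n ⟨
    suc (C * A) * n / n  ≤⟨ /-monoˡ-≤ n (<⇒≤ (n<[2+m]^n e i)) ⟩
    ℓ ^ i / n            ∎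

  ℓ^i≡Kn+d : ℓ ^ i ≡ K * n + d
  ℓ^i≡Kn+d = trans (m≡m%n+[m/n]*n (ℓ ^ i) n) (+-comm d (K * n))

  |T|≤cᴷmⁿ : length T ≤ c ^ K * m ^ n
  |T|≤cᴷmⁿ = ≤-trans
    (powerFreeSet-length≤ {k = k} {K = K} {d = d} count (subst (λ N → PowerFreeSet k N T) ℓ^i≡Kn+d T-set))
    (*-monoʳ-≤ (c ^ K) (^-monoʳ-≤ m (<⇒≤ (m%n<n (ℓ ^ i) n))))

  nK≤ℓ^i : n * K ≤ ℓ ^ i
  nK≤ℓ^i = subst₂ _≤_ (*-comm K n) (sym ℓ^i≡Kn+d) (m≤m+n (K * n) d)

  rⁿᴷ≤C*cᵉᴷ : (r ^ n) ^ K ≤ C * A ^ K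
  rⁿᴷ≤C*cᵉᴷ = begin
    (r ^ n) ^ K                             ≡⟨ ^-*-assoc r n K ⟩
    r ^ (n * K)                             ≤⟨ ^-monoʳ-≤ r nK≤ℓ^i ⟩
    r ^ (ℓ ^ i)                             ≤⟨ T-large ⟩
    r * length T ^ suc e                    ≤⟨ *-monoʳ-≤ r (^-monoˡ-≤ (suc e) |T|≤cᴷmⁿ) ⟩
    r * (c ^ K * m ^ n) ^ suc e             ≡⟨ cong (r *_) (^-distribʳ-* (c ^ K) (m ^ n) (suc e)) ⟩
    r * ((c ^ K) ^ suc e * (m ^ n) ^ suc e) ≡⟨ cong (λ x → r * (x * (m ^ n) ^ suc e))
                                                    (^-comm-exponents c K (suc e)) ⟩
    r * (A ^ K * (m ^ n) ^ suc e)           ≡⟨ regroup r (A ^ K) ((m ^ n) ^ suc e) ⟩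
    C * A ^ K                               ∎
    where
    regroup : ∀ r x y → r * (x * y) ≡ r * y * x
    regroup = solve-∀

mainTheorem1 : (k m r ℓ : ℕ) → 2 ≤ k → 1 ≤ m → 1 < r →
    (ρ : Word (Fin (r * m)) → Word (Fin m)) →
    IsMorphism ρ → IsUniform ℓ ρ → IsPowerFreeMorphism k ρ →
    (ℓ ≡ 0) ⊎ EntropyAtLeastLogOver k m r ℓ
mainTheorem1 k m r zero _ _ _ _ _ _ _ = inj₁ refl
mainTheorem1 (suc (suc j)) m@(suc _) r (suc zero) (s≤s (s≤s _)) _ 1<r ρ ρ-++ ρ-uniform ρ-powerFree =
  ⊥-elim (<⇒≱ (subst (m <_) (*-comm m r) (m<m*n m r 1<r))
              (uniform₁⇒alphabet≤ j {ρ} ρ-++ ρ-uniform ρ-powerFree))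
mainTheorem1 (suc (suc j)) m@(suc _) r (suc (suc e)) (s≤s (s≤s _)) _ 1<r ρ ρ-++ ρ-uniform ρ-powerFree =
  inj₂ λ p q p<q → 1 , λ where
    n@(suc _) _ c count → begin
      r ^ (n * p)      ≤⟨ ^-monoʳ-≤ r (*-monoʳ-≤ n (<⇒≤ p<q)) ⟩
      r ^ (n * q)      ≡⟨ ^-*-assoc r n q ⟨
      (r ^ n) ^ q      ≤⟨ ^-monoˡ-≤ q (powerFreeCount-lowerBound {k = 2 + j} {n = n} large count) ⟩
      (c ^ suc e) ^ q  ≡⟨ ^-*-assoc c (suc e) q ⟩
      c ^ (suc e * q)  ∎
  where
  open ≤-Reasoning
  instance
    r≢0 : NonZero r
    r≢0 = >-nonZero (<⇒≤ 1<r)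
  large : ∀ i → Σ[ T ∈ List (Word (Fin m)) ]
    PowerFreeSet (2 + j) (suc (suc e) ^ i) T × r ^ (suc (suc e) ^ i) ≤ r * length T ^ suc e
  large = powerFreeSets-ℓ^ {j = j} ρ-++ ρ-uniform ρ-powerFree fzero
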